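{- Let $K$ be a real closed field, $C$ a multiplicative cut in $K$, and $L$ the real closure of $K(x)$, where $x$ realizes the cut $C$. Then for any $y\in L$ realizing the same cut $C$, we have $x^{1/n}<y<x^n$ for some positive integer $n$.
   Context: A cut of $K$ is a pair $C=(C^-,C^+)$ with $K=C^-\cup C^+$ disjoint and $C^-<C^+$; an element $x$ of an ordered field extending $K$ realizes $C$ if $C^-<x<C^+$. $C$ is multiplicative if $C^-\cap\{c\in K:c>0\}$ is closed under multiplication and contains $2$. -}

module Defs where

open import Level using (Level; _⊔_; suc)
open import Data.Nat using (ℕ; zero) renaming (suc to sucℕ; _+_ to _+ℕ_)
open import Data.List using (List; []; _∷_; length)
import Data.List
open import Data.List.Relation.Unary.Any using (Any)
open import Data.Product using (Σ; ∃; _×_; _,_)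
open import Data.Sum using (_⊎_)
open import Relation.Nullary using (¬_)
open import Relation.Binary.PropositionalEquality using (_≡_)
open import Relation.Binary.Structures using (IsStrictPartialOrder)
open import Algebra.Bundles using (CommutativeRing)

record OrderedField (c ℓ r : Level) : Set (suc (c ⊔ ℓ ⊔ r)) where
  field
    commRing : CommutativeRing c ℓ
  open CommutativeRing commRing public
  infix 4 _<_
  field
    _<_           : Carrier → Carrier → Set r
    <-isSPO       : IsStrictPartialOrder _≈_ _<_
    <-total       : ∀ x y → ¬ (x ≈ y) → (x < y) ⊎ (y < x)
    0<1           : 0# < 1#
    +-mono-<      : ∀ {x y} z → x < y → x + z < y + z
    *-pos         : ∀ {x y} → 0# < x → 0# < y → 0# < x * y
    inverse       : ∀ x → ¬ (x ≈ 0#) → ∃ λ y → x * y ≈ 1#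

  _≤_ : Carrier → Carrier → Set (ℓ ⊔ r)
  x ≤ y = (x < y) ⊎ (x ≈ y)

  _^_ : Carrier → ℕ → Carrier
  x ^ zero   = 1#
  x ^ sucℕ n = x * (x ^ n)

  evalPoly : List Carrier → Carrier → Carrier
  evalPoly []       r = 0#
  evalPoly (a ∷ as) r = a + r * evalPoly as r

  two : Carrier
  two = 1# + 1#

-- The monic polynomial of degree 2k+1 is a₀ + a₁X + … + a₂ₖX²ᵏ + X²ᵏ⁺¹,
-- given by the list cs = (a₀,…,a₂ₖ).
record IsRealClosed {c ℓ r} (F : OrderedField c ℓ r) : Set (c ⊔ ℓ ⊔ r) where
  open OrderedField F
  field
    sqrt     : ∀ x → 0# ≤ x → ∃ λ y → y * y ≈ x
    oddRoot  : ∀ (k : ℕ) (cs : List Carrier) → length cs ≡ sucℕ (k +ℕ k) →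
               ∃ λ t → evalPoly cs t + t ^ length cs ≈ 0#

record OFEmbedding {c ℓ r c' ℓ' r'} (K : OrderedField c ℓ r) (L : OrderedField c' ℓ' r')
       : Set (c ⊔ ℓ ⊔ r ⊔ c' ⊔ ℓ' ⊔ r') where
  private
    module K = OrderedField K
    module L = OrderedField L
  field
    ⟦_⟧    : K.Carrier → L.Carrier
    cong   : ∀ {a b} → a K.≈ b → ⟦ a ⟧ L.≈ ⟦ b ⟧
    +-hom  : ∀ a b → ⟦ a K.+ b ⟧ L.≈ ⟦ a ⟧ L.+ ⟦ b ⟧
    *-hom  : ∀ a b → ⟦ a K.* b ⟧ L.≈ ⟦ a ⟧ L.* ⟦ b ⟧
    1-hom  : ⟦ K.1# ⟧ L.≈ L.1#
    <-hom  : ∀ {a b} → a K.< b → ⟦ a ⟧ L.< ⟦ b ⟧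

record Cut {c ℓ r} (K : OrderedField c ℓ r) (p : Level) : Set (c ⊔ ℓ ⊔ r ⊔ suc p) where
  open OrderedField K
  field
    Lower     : Carrier → Set p
    Upper     : Carrier → Set p
    cover     : ∀ a → Lower a ⊎ Upper a
    disjoint  : ∀ a → ¬ (Lower a × Upper a)
    below     : ∀ {a b} → Lower a → Upper b → a < b

record IsMultiplicative {c ℓ r p} {K : OrderedField c ℓ r} (C : Cut K p) : Set (c ⊔ r ⊔ p) where
  open OrderedField K
  open Cut C
  field
    two-lower : Lower two
    mul-lower : ∀ a b → 0# < a → 0# < b → Lower a → Lower b → Lower (a * b)

Realizes : ∀ {c ℓ r c' ℓ' r' p} {K : OrderedField c ℓ r} {L : OrderedField c' ℓ' r'} →
           OFEmbedding K L → Cut K p → OrderedField.Carrier L → Set (c ⊔ r' ⊔ p)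
Realizes {K = K} {L} ι C x =
  (∀ a → Cut.Lower C a → ⟦ a ⟧ L.< x) × (∀ a → Cut.Upper C a → x L.< ⟦ a ⟧)
  where
    module L = OrderedField L
    open OFEmbedding ι

-- y ∈ L is algebraic over K(x) (x ∈ L, K embedded via ι): there is a nonzero
-- polynomial over K(x) vanishing at y.  After clearing denominators its
-- coefficients lie in K[x]; so it is given by a list (in powers of Y) of
-- coefficient polynomials in K[X], at least one of which is nonzero at x.
AlgebraicOver : ∀ {c ℓ r c' ℓ' r'} {K : OrderedField c ℓ r} {L : OrderedField c' ℓ' r'} →
                OFEmbedding K L → OrderedField.Carrier L → OrderedField.Carrier L → Set (c ⊔ ℓ')
AlgebraicOver {K = K} {L} ι x y =
  ∃ λ (P : List (List K.Carrier)) →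
    Any (λ q → ¬ (coeff q L.≈ L.0#)) P × (L.evalPoly (Data.List.map coeff P) y L.≈ L.0#)
  where
    module K = OrderedField K
    module L = OrderedField L
    open OFEmbedding ι
    coeff : List K.Carrier → L.Carrier
    coeff q = L.evalPoly (Data.List.map ⟦_⟧ q) x

record IsRealClosureOfSimpleExt {c ℓ r c' ℓ' r' p} {K : OrderedField c ℓ r}
       (C : Cut K p) (L : OrderedField c' ℓ' r') (ι : OFEmbedding K L)
       (x : OrderedField.Carrier L) : Set (c ⊔ ℓ ⊔ r ⊔ c' ⊔ ℓ' ⊔ r' ⊔ p) where
  field
    realClosed : IsRealClosed L
    realizes   : Realizes ι C x
    algebraic  : ∀ y → AlgebraicOver ι x y

module Submission where

-- As y is algebraic over K(x), some relation Σ cᵢⱼ xⁱ yʲ = 0 with coefficients in K,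
-- not all zero, holds; let D bound its degrees in x and in y. If y ≥ x^(D+1), one
-- monomial dominates all others. Let A = max |cᵢⱼ|, and call cᵢⱼ large when A/|cᵢⱼ|
-- lies in C⁻ and small when it lies in C⁺. Among the large monomials take the one with
-- lexicographically greatest (j, i). Every other monomial is smaller by a factor
-- exceeding the number of monomials: a large one loses a factor x against it, and x
-- exceeds s·n for every s ∈ C⁻ and n ∈ ℕ as C⁻ is multiplicative; a small one is
-- bounded through the element A/|cᵢⱼ| of C⁺, whose roots stay in C⁺ and so exceed x
-- and y. Hence the relation cannot hold, and y < x^(D+1). Exchanging x and y gives
-- x < y^(D+1), that is x^(1/(D+1)) < y.

open import Defs
open import Level using (0ℓ; _⊔_)
open import Algebra using (CommutativeRing; RawRing)
open import Data.Nat as ℕ using (ℕ; zero; suc; _≤_)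
import Data.Nat.Properties as ℕₚ
open import Data.List using (List; []; _∷_; _++_; length; map)
open import Data.List.Relation.Unary.All as All using (All; []; _∷_)
open import Data.List.Relation.Unary.AllPairs using (AllPairs; []; _∷_)
open import Data.Maybe using (Maybe; just; nothing)
open import Data.Product using (Σ; ∃; _×_; _,_; proj₁; proj₂)
open import Data.Sum using (_⊎_; inj₁; inj₂; [_,_])
open import Data.Empty using (⊥; ⊥-elim)
open import Relation.Nullary using (¬_; yes; no)
import Relation.Binary.PropositionalEquality as ≡
open ≡ using (_≡_)

module IntegerCoefficientSolver {c ℓ} (R : CommutativeRing c ℓ) where
  open CommutativeRing R
  open import Algebra.Properties.Semiring.Mult.TCOptimised semiring using (×-homo-+; ×1-homo-*) renaming (_×_ to _×ₘ_)
  open import Algebra.Properties.Ring ring using (-‿involutive; -‿distribˡ-*; -‿distribʳ-*; -‿+-comm; -0#≈0#)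
  open import Algebra.Properties.CommutativeSemigroup +-commutativeSemigroup using (interchange)
  open import Algebra.Properties.Group +-group using (x∙y⁻¹≈ε⇒x≈y)
  open import Algebra.Solver.Ring.AlmostCommutativeRing using (_-Raw-AlmostCommutative⟶_; fromCommutativeRing)
  open import Relation.Binary.Reasoning.Setoid setoid

  private
    fromℕ : ℕ → Carrier
    fromℕ n = n ×ₘ 1#

  -- Integer coefficients for Algebra.Solver.Ring, as formal differences: (a , b)
  -- stands for a − b. Deciding a + d ≟ c + b lets the solver cancel terms, which it
  -- cannot do with coefficients from the (undecidable) carrier of R.
  ℕ²-rawRing : RawRing 0ℓ 0ℓ
  ℕ²-rawRing = record
    { Carrier = ℕ × ℕ
    ; _≈_     = _≡_
    ; _+_     = λ { (a , b) (c , d) → (a ℕ.+ c , b ℕ.+ d) }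
    ; _*_     = λ { (a , b) (c , d) → (a ℕ.* c ℕ.+ b ℕ.* d , a ℕ.* d ℕ.+ b ℕ.* c) }
    ; -_      = λ { (a , b) → (b , a) }
    ; 0#      = (0 , 0)
    ; 1#      = (1 , 0)
    }

  -- Cancelling common successors first makes e.g. (2 , 1) evaluate to 1#
  -- definitionally, which the solver's final refl step relies on.
  ⟦_⟧ℕ² : ℕ × ℕ → Carrier
  ⟦ (a , zero) ⟧ℕ²        = fromℕ a
  ⟦ (zero , suc b) ⟧ℕ²    = - fromℕ (suc b)
  ⟦ (suc a , suc b) ⟧ℕ²   = ⟦ (a , b) ⟧ℕ²

  ⟦⟧ℕ²-difference : ∀ a b → ⟦ (a , b) ⟧ℕ² ≈ fromℕ a - fromℕ b
  ⟦⟧ℕ²-difference a       zero    = trans (sym (+-identityʳ (fromℕ a))) (+-congˡ (sym -0#≈0#))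
  ⟦⟧ℕ²-difference zero    (suc b) = sym (+-identityˡ _)
  ⟦⟧ℕ²-difference (suc a) (suc b) = trans (⟦⟧ℕ²-difference a b) (begin
    fromℕ a - fromℕ b                       ≈⟨ sym (+-identityˡ _) ⟩
    0# + (fromℕ a - fromℕ b)                ≈⟨ +-congʳ (sym (-‿inverseʳ 1#)) ⟩
    (1# - 1#) + (fromℕ a - fromℕ b)         ≈⟨ interchange _ _ _ _ ⟩
    (1# + fromℕ a) + (- 1# - fromℕ b)       ≈⟨ +-cong (sym (×-homo-+ 1# 1 a)) (trans (-‿+-comm _ _) (-‿cong (sym (×-homo-+ 1# 1 b)))) ⟩
    fromℕ (suc a) - fromℕ (suc b)           ∎)

  -‿distrib-+ : ∀ x y → - (x + y) ≈ - x + - y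
  -‿distrib-+ x y = sym (-‿+-comm x y)

  -‿+-homo : ∀ a b c d → (a + c) - (b + d) ≈ (a - b) + (c - d)
  -‿+-homo a b c d = trans (+-congˡ (-‿distrib-+ b d)) (interchange a c (- b) (- d))

  -‿*-homo : ∀ a b c d → (a * c + b * d) - (a * d + b * c) ≈ (a - b) * (c - d)
  -‿*-homo a b c d = sym (begin
    (a - b) * (c - d)                           ≈⟨ distribʳ (c - d) a (- b) ⟩
    a * (c - d) + - b * (c - d)                 ≈⟨ +-cong (distribˡ a c (- d)) (distribˡ (- b) c (- d)) ⟩
    (a * c + a * - d) + (- b * c + - b * - d)   ≈⟨ +-cong (+-congˡ (sym (-‿distribʳ-* a d))) (+-cong (sym (-‿distribˡ-* b c)) neg-neg) ⟩
    (a * c - a * d) + (- (b * c) + b * d)       ≈⟨ +-congˡ (+-comm _ _) ⟩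
    (a * c - a * d) + (b * d - b * c)           ≈⟨ interchange _ _ _ _ ⟩
    (a * c + b * d) + (- (a * d) + - (b * c))   ≈⟨ +-congˡ (-‿+-comm _ _) ⟩
    (a * c + b * d) - (a * d + b * c)           ∎)
    where
    neg-neg : - b * - d ≈ b * d
    neg-neg = trans (sym (-‿distribˡ-* b (- d))) (trans (-‿cong (sym (-‿distribʳ-* b d))) (-‿involutive (b * d)))

  private
    difference : ℕ × ℕ → Carrier
    difference (a , b) = fromℕ a - fromℕ b

  difference-morphism : ℕ²-rawRing -Raw-AlmostCommutative⟶ fromCommutativeRing R
  difference-morphism = record
    { ⟦_⟧    = difference
    ; +-homo = λ { (a , b) (c , d) → trans (+-cong (×-homo-+ 1# a c) (-‿cong (×-homo-+ 1# b d)))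
                                           (-‿+-homo (fromℕ a) (fromℕ b) (fromℕ c) (fromℕ d)) }
    ; *-homo = λ { (a , b) (c , d) → trans (+-cong (fromℕ-+* a c b d) (-‿cong (fromℕ-+* a d b c)))
                                           (-‿*-homo (fromℕ a) (fromℕ b) (fromℕ c) (fromℕ d)) }
    ; -‿homo = λ { (a , b) → trans (+-comm (fromℕ b) (- fromℕ a))
                                (trans (+-congˡ (sym (-‿involutive (fromℕ b)))) (sym (-‿distrib-+ (fromℕ a) (- fromℕ b)))) }
    ; 0-homo = -‿inverseʳ 0#
    ; 1-homo = trans (+-congˡ -0#≈0#) (+-identityʳ 1#)
    }
    where
    fromℕ-+* : ∀ a c b d → fromℕ (a ℕ.* c ℕ.+ b ℕ.* d) ≈ fromℕ a * fromℕ c + fromℕ b * fromℕ d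
    fromℕ-+* a c b d = trans (×-homo-+ 1# (a ℕ.* c) (b ℕ.* d)) (+-cong (×1-homo-* a c) (×1-homo-* b d))

  ℕ²-morphism : ℕ²-rawRing -Raw-AlmostCommutative⟶ fromCommutativeRing R
  ℕ²-morphism = record
    { ⟦_⟧    = ⟦_⟧ℕ²
    ; +-homo = λ p q → via (p N.+ q) (+-cong (⟦⟧ℕ²-difference′ p) (⟦⟧ℕ²-difference′ q)) (D.+-homo p q)
    ; *-homo = λ p q → via (p N.* q) (*-cong (⟦⟧ℕ²-difference′ p) (⟦⟧ℕ²-difference′ q)) (D.*-homo p q)
    ; -‿homo = λ p → via (N.- p) (-‿cong (⟦⟧ℕ²-difference′ p)) (D.-‿homo p)
    ; 0-homo = via (0 , 0) refl D.0-homo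
    ; 1-homo = via (1 , 0) refl D.1-homo
    }
    where
    module D = _-Raw-AlmostCommutative⟶_ difference-morphism
    module N = RawRing ℕ²-rawRing
    ⟦⟧ℕ²-difference′ : ∀ p → ⟦ p ⟧ℕ² ≈ difference p
    ⟦⟧ℕ²-difference′ (a , b) = ⟦⟧ℕ²-difference a b
    via : ∀ p {x y} → x ≈ y → difference p ≈ y → ⟦ p ⟧ℕ² ≈ x
    via p x≈y e = trans (⟦⟧ℕ²-difference′ p) (trans e (sym x≈y))

  ⟦⟧ℕ²-equal? : ∀ p q → Maybe (⟦ p ⟧ℕ² ≈ ⟦ q ⟧ℕ²)
  ⟦⟧ℕ²-equal? (a , b) (c , d) with a ℕ.+ d ℕ.≟ c ℕ.+ b
  ... | no _  = nothing
  ... | yes e = just (trans (⟦⟧ℕ²-difference a b) (trans difference-equal (sym (⟦⟧ℕ²-difference c d))))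
    where
    difference-equal : fromℕ a - fromℕ b ≈ fromℕ c - fromℕ d
    difference-equal = x∙y⁻¹≈ε⇒x≈y _ _ (begin
      (fromℕ a - fromℕ b) - (fromℕ c - fromℕ d)     ≈⟨ +-congˡ (trans (-‿distrib-+ (fromℕ c) (- fromℕ d)) (+-congˡ (-‿involutive (fromℕ d)))) ⟩
      (fromℕ a - fromℕ b) + (- fromℕ c + fromℕ d)   ≈⟨ +-congˡ (+-comm _ _) ⟩
      (fromℕ a - fromℕ b) + (fromℕ d - fromℕ c)     ≈⟨ interchange _ _ _ _ ⟩
      (fromℕ a + fromℕ d) + (- fromℕ b - fromℕ c)   ≈⟨ +-cong (sym (×-homo-+ 1# a d)) (trans (-‿+-comm _ _) (-‿cong (trans (+-comm _ _) (sym (×-homo-+ 1# c b))))) ⟩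
      fromℕ (a ℕ.+ d) - fromℕ (c ℕ.+ b)             ≈⟨ +-congʳ (reflexive (≡.cong fromℕ e)) ⟩
      fromℕ (c ℕ.+ b) - fromℕ (c ℕ.+ b)             ≈⟨ -‿inverseʳ _ ⟩
      0#                                            ∎)

  open import Algebra.Solver.Ring ℕ²-rawRing (fromCommutativeRing R) ℕ²-morphism ⟦⟧ℕ²-equal? public
    using (solve; _:=_; _:+_; _:*_; :-_; _:-_)

module OrderedFieldProperties {c ℓ r} (F : OrderedField c ℓ r) where
  open OrderedField F public
  open IntegerCoefficientSolver commRing public using (solve; _:=_; _:+_; _:*_; :-_; _:-_)
  open import Algebra.Properties.Ring ring public using (-‿involutive; -‿distribˡ-*; -‿+-comm; -0#≈0#)
  open import Relation.Binary.Structures using (IsStrictPartialOrder)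
  private module SPO = IsStrictPartialOrder <-isSPO

  fromℕ : ℕ → Carrier
  fromℕ zero    = 0#
  fromℕ (suc n) = 1# + fromℕ n

  -- The order _≤_ of OrderedField is a sum (x < y ⊎ x ≈ y) that cannot be obtained
  -- without deciding ≈; its negative counterpart _≼_ is stable under double negation
  -- and carries all non-strict reasoning below.
  infix 4 _≼_ _≍_ ∣_∣≼_ _≈±_
  _≼_ : Carrier → Carrier → Set r
  a ≼ b = ¬ (b < a)

  _≍_ : Carrier → Carrier → Set r
  a ≍ b = (a ≼ b) × (b ≼ a)

  ∣_∣≼_ : Carrier → Carrier → Set r
  ∣ a ∣≼ b = (- b ≼ a) × (a ≼ b)

  _≈±_ : Carrier → Carrier → Set ℓ
  a ≈± b = (a ≈ b) ⊎ (a ≈ - b)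

  <-irrefl : ∀ {a b} → a ≈ b → ¬ (a < b)
  <-irrefl = SPO.irrefl

  <-trans : ∀ {a b c} → a < b → b < c → a < c
  <-trans = SPO.trans

  <-resp-≈ : ∀ {a a′ b b′} → a ≈ a′ → b ≈ b′ → a < b → a′ < b′
  <-resp-≈ p q h = SPO.<-respʳ-≈ q (SPO.<-respˡ-≈ p h)

  <-asym : ∀ {a b} → a < b → ¬ (b < a)
  <-asym p q = <-irrefl refl (<-trans p q)

  <-stable : ∀ {a b} → ¬ ¬ (a < b) → a < b
  <-stable {a} {b} h with <-total a b (λ e → h (<-irrefl e))
  ... | inj₁ a<b = a<b
  ... | inj₂ b<a = ⊥-elim (h (<-asym b<a))

  trichotomy : ∀ a b → ¬ (a < b) → ¬ (a ≈ b) → ¬ (b < a) → ⊥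
  trichotomy a b a≮b a≉b b≮a = [ a≮b , b≮a ] (<-total a b a≉b)

  ≼-refl : ∀ {a} → a ≼ a
  ≼-refl = <-irrefl refl

  ≈⇒≼ : ∀ {a b} → a ≈ b → a ≼ b
  ≈⇒≼ e = <-irrefl (sym e)

  <⇒≼ : ∀ {a b} → a < b → a ≼ b
  <⇒≼ = <-asym

  ≼-total-¬¬ : ∀ a b → ¬ ¬ ((a ≼ b) ⊎ (b ≼ a))
  ≼-total-¬¬ a b k = k (inj₁ λ b<a → k (inj₂ (<⇒≼ b<a)))

  ≼-resp-≈ : ∀ {a a′ b b′} → a ≈ a′ → b ≈ b′ → a ≼ b → a′ ≼ b′
  ≼-resp-≈ p q h b′<a′ = h (<-resp-≈ (sym q) (sym p) b′<a′)

  ≼-trans : ∀ {a b c} → a ≼ b → b ≼ c → a ≼ c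
  ≼-trans {a} {b} {c} a≼b b≼c c<a =
    trichotomy b a a≼b (λ e → b≼c (<-resp-≈ refl (sym e) c<a)) (λ a<b → b≼c (<-trans c<a a<b))

  <-≼-trans : ∀ {a b c} → a < b → b ≼ c → a < c
  <-≼-trans a<b b≼c = <-stable (λ c≼a → ≼-trans b≼c c≼a a<b)

  +-monoʳ-< : ∀ {a b} c → a < b → c + a < c + b
  +-monoʳ-< {a} {b} c h = <-resp-≈ (+-comm a c) (+-comm b c) (+-mono-< c h)

  +-cancelʳ-< : ∀ {a b} c → a + c < b + c → a < b
  +-cancelʳ-< {a} {b} c h =
    <-resp-≈ (solve 2 (λ a c → a :+ c :- c := a) refl a c) (solve 2 (λ b c → b :+ c :- c := b) refl b c) (+-mono-< (- c) h)

  +-monoˡ-≼ : ∀ {a b} c → a ≼ b → a + c ≼ b + c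
  +-monoˡ-≼ c h l = h (+-cancelʳ-< c l)

  +-monoʳ-≼ : ∀ {a b} c → a ≼ b → c + a ≼ c + b
  +-monoʳ-≼ {a} {b} c h = ≼-resp-≈ (+-comm a c) (+-comm b c) (+-monoˡ-≼ c h)

  +-mono-≼ : ∀ {a b c d} → a ≼ b → c ≼ d → a + c ≼ b + d
  +-mono-≼ {a} {b} {c} p q = ≼-trans (+-monoˡ-≼ c p) (+-monoʳ-≼ b q)

  neg-antimono-< : ∀ {a b} → a < b → - b < - a
  neg-antimono-< {a} {b} h =
    <-resp-≈ (solve 2 (λ a b → a :+ (:- a :- b) := :- b) refl a b) (solve 2 (λ a b → b :+ (:- a :- b) := :- a) refl a b) (+-mono-< (- a - b) h)

  neg-antimono-≼ : ∀ {a b} → a ≼ b → - b ≼ - a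
  neg-antimono-≼ h l = h (<-resp-≈ (-‿involutive _) (-‿involutive _) (neg-antimono-< l))

  0≼x⇒-x≼x : ∀ {a} → 0# ≼ a → - a ≼ a
  0≼x⇒-x≼x 0≼a = ≼-trans (≼-resp-≈ refl -0#≈0# (neg-antimono-≼ 0≼a)) 0≼a

  x<y⇒0<y-x : ∀ {a b} → a < b → 0# < b - a
  x<y⇒0<y-x {a} h = <-resp-≈ (-‿inverseʳ a) refl (+-mono-< (- a) h)

  0<y-x⇒x<y : ∀ {a b} → 0# < b - a → a < b
  0<y-x⇒x<y {a} {b} h = <-resp-≈ (+-identityˡ a) (solve 2 (λ a b → b :- a :+ a := b) refl a b) (+-mono-< a h)

  *-monoˡ-< : ∀ {a b c} → 0# < c → a < b → a * c < b * c
  *-monoˡ-< {a} {b} {c} 0<c a<b =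
    0<y-x⇒x<y (<-resp-≈ refl (solve 3 (λ a b c → (b :- a) :* c := b :* c :- a :* c) refl a b c) (*-pos (x<y⇒0<y-x a<b) 0<c))

  0<⇒≉0 : ∀ {a} → 0# < a → ¬ (a ≈ 0#)
  0<⇒≉0 0<a e = <-irrefl (sym e) 0<a

  *-monoˡ-≼ : ∀ {a b c} → 0# ≼ c → a ≼ b → a * c ≼ b * c
  *-monoˡ-≼ {a} {b} {c} 0≼c a≼b bc<ac = trichotomy c 0# 0≼c
    (λ c≈0 → <-irrefl (trans (*-congˡ c≈0) (trans (zeroʳ b) (sym (trans (*-congˡ c≈0) (zeroʳ a))))) bc<ac)
    (λ 0<c → trichotomy a b (λ a<b → <-asym (*-monoˡ-< 0<c a<b) bc<ac) (λ a≈b → <-irrefl (*-congʳ (sym a≈b)) bc<ac) a≼b)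

  *-monoʳ-≼ : ∀ {a b c} → 0# ≼ c → a ≼ b → c * a ≼ c * b
  *-monoʳ-≼ {a} {b} {c} 0≼c a≼b = ≼-resp-≈ (*-comm a c) (*-comm b c) (*-monoˡ-≼ 0≼c a≼b)

  *-mono-≼ : ∀ {a b c d} → 0# ≼ a → 0# ≼ c → a ≼ b → c ≼ d → a * c ≼ b * d
  *-mono-≼ 0≼a 0≼c a≼b c≼d = ≼-trans (*-monoˡ-≼ 0≼c a≼b) (*-monoʳ-≼ (≼-trans 0≼a a≼b) c≼d)

  *-cancelʳ-≼ : ∀ {a b c} → 0# < c → a * c ≼ b * c → a ≼ b
  *-cancelʳ-≼ 0<c h b<a = h (*-monoˡ-< 0<c b<a)

  *-cancelˡ-≼ : ∀ {a b c} → 0# < c → c * a ≼ c * b → a ≼ b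
  *-cancelˡ-≼ {a} {b} {c} 0<c h = *-cancelʳ-≼ 0<c (≼-resp-≈ (*-comm c a) (*-comm c b) h)

  0≼* : ∀ {a b} → 0# ≼ a → 0# ≼ b → 0# ≼ a * b
  0≼* {a} {b} 0≼a 0≼b = ≼-resp-≈ (zeroˡ b) refl (*-monoˡ-≼ 0≼b 0≼a)

  positive-quotient : ∀ {a b} → 0# < a → 0# < b → ∃ λ q → (0# < q) × (b ≈ q * a)
  positive-quotient {a} {b} 0<a 0<b with inverse a (0<⇒≉0 0<a)
  ... | a⁻¹ , aa⁻¹≈1 = b * a⁻¹ , *-pos 0<b 0<a⁻¹ , b≈ba⁻¹a
    where
    0<a⁻¹ : 0# < a⁻¹
    0<a⁻¹ = <-stable λ a⁻¹≼0 → *-monoʳ-≼ (<⇒≼ 0<a) a⁻¹≼0 (<-resp-≈ (sym (zeroʳ a)) (sym aa⁻¹≈1) 0<1)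
    b≈ba⁻¹a : b ≈ b * a⁻¹ * a
    b≈ba⁻¹a = trans (sym (*-identityʳ b))
      (trans (*-congˡ (sym aa⁻¹≈1)) (solve 3 (λ b t a → b :* (a :* t) := b :* t :* a) refl b a⁻¹ a))

  1<two : 1# < two
  1<two = <-resp-≈ (+-identityˡ 1#) refl (+-mono-< 1# 0<1)

  0<two : 0# < two
  0<two = <-trans 0<1 1<two

  0≼fromℕ : ∀ n → 0# ≼ fromℕ n
  0≼fromℕ zero    = ≼-refl
  0≼fromℕ (suc n) = ≼-resp-≈ (+-identityˡ 0#) refl (+-mono-≼ (<⇒≼ 0<1) (0≼fromℕ n))

  0<fromℕ-suc : ∀ n → 0# < fromℕ (suc n)
  0<fromℕ-suc n = <-≼-trans 0<1 (≼-resp-≈ (+-identityʳ 1#) refl (+-monoʳ-≼ 1# (0≼fromℕ n)))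

  ^-congˡ : ∀ {a b} n → a ≈ b → a ^ n ≈ b ^ n
  ^-congˡ zero    e = refl
  ^-congˡ (suc n) e = *-cong e (^-congˡ n e)

  ^-distribˡ-+-* : ∀ a m n → a ^ (m ℕ.+ n) ≈ a ^ m * a ^ n
  ^-distribˡ-+-* a zero    n = sym (*-identityˡ _)
  ^-distribˡ-+-* a (suc m) n = trans (*-congˡ (^-distribˡ-+-* a m n)) (sym (*-assoc _ _ _))

  ^-distribʳ-* : ∀ a b n → (a * b) ^ n ≈ a ^ n * b ^ n
  ^-distribʳ-* a b zero    = sym (*-identityˡ 1#)
  ^-distribʳ-* a b (suc n) = trans (*-congˡ (^-distribʳ-* a b n))
    (solve 4 (λ a b x y → (a :* b) :* (x :* y) := (a :* x) :* (b :* y)) refl a b (a ^ n) (b ^ n))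

  0<^ : ∀ {a} n → 0# < a → 0# < a ^ n
  0<^ zero    0<a = 0<1
  0<^ (suc n) 0<a = *-pos 0<a (0<^ n 0<a)

  0≼^ : ∀ {a} n → 0# ≼ a → 0# ≼ a ^ n
  0≼^ zero    0≼a = <⇒≼ 0<1
  0≼^ (suc n) 0≼a = 0≼* 0≼a (0≼^ n 0≼a)

  ^-monoˡ-≼ : ∀ {a b} n → 0# ≼ a → a ≼ b → a ^ n ≼ b ^ n
  ^-monoˡ-≼ zero    0≼a a≼b = ≼-refl
  ^-monoˡ-≼ (suc n) 0≼a a≼b = *-mono-≼ 0≼a (0≼^ n 0≼a) a≼b (^-monoˡ-≼ n 0≼a a≼b)

  1≼^ : ∀ {a} n → 1# ≼ a → 1# ≼ a ^ n
  1≼^ zero    1≼a = ≼-refl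
  1≼^ (suc n) 1≼a = ≼-resp-≈ (*-identityˡ 1#) refl (*-mono-≼ (<⇒≼ 0<1) (<⇒≼ 0<1) 1≼a (1≼^ n 1≼a))

  ^-monoʳ-≼ : ∀ {a m n} → 1# ≼ a → m ℕ.≤ n → a ^ m ≼ a ^ n
  ^-monoʳ-≼ {a} {m} {n} 1≼a m≤n =
    ≼-resp-≈ (*-identityʳ _) (trans (sym (^-distribˡ-+-* a m (n ℕ.∸ m))) (reflexive (≡.cong (a ^_) (ℕₚ.m+[n∸m]≡n m≤n))))
      (*-monoʳ-≼ (0≼^ m (≼-trans (<⇒≼ 0<1) 1≼a)) (1≼^ (n ℕ.∸ m) 1≼a))

module EmbeddingProperties {c ℓ r c′ ℓ′ r′} {K : OrderedField c ℓ r} {L : OrderedField c′ ℓ′ r′}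
                           (ι : OFEmbedding K L) where
  private
    module K = OrderedFieldProperties K
    module L = OrderedFieldProperties L
  open OFEmbedding ι public

  0-hom : ⟦ K.0# ⟧ L.≈ L.0#
  0-hom = L.trans (L.solve 1 (λ z → z := z :+ z :- z) L.refl ⟦ K.0# ⟧)
    (L.trans (L.+-congʳ (L.trans (L.sym (+-hom K.0# K.0#)) (cong (K.+-identityʳ K.0#)))) (L.-‿inverseʳ ⟦ K.0# ⟧))
    where open L using (_:=_; _:+_; _:-_)

  -‿hom : ∀ a → ⟦ K.- a ⟧ L.≈ L.- ⟦ a ⟧
  -‿hom a = L.trans (L.solve 2 (λ x y → y := (x :+ y) :- x) L.refl ⟦ a ⟧ ⟦ K.- a ⟧)
    (L.trans (L.+-congʳ (L.trans (L.sym (+-hom a (K.- a))) (L.trans (cong (K.-‿inverseʳ a)) 0-hom))) (L.+-identityˡ _))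
    where open L using (_:=_; _:+_; _:-_)

  ^-hom : ∀ a n → ⟦ a K.^ n ⟧ L.≈ ⟦ a ⟧ L.^ n
  ^-hom a zero    = 1-hom
  ^-hom a (suc n) = L.trans (*-hom a (a K.^ n)) (L.*-congˡ (^-hom a n))

  fromℕ-hom : ∀ n → ⟦ K.fromℕ n ⟧ L.≈ L.fromℕ n
  fromℕ-hom zero    = 0-hom
  fromℕ-hom (suc n) = L.trans (+-hom K.1# (K.fromℕ n)) (L.+-cong 1-hom (fromℕ-hom n))

  ≼-hom : ∀ {a b} → a K.≼ b → ⟦ a ⟧ L.≼ ⟦ b ⟧
  ≼-hom {a} {b} a≼b ⟦b⟧<⟦a⟧ =
    K.trichotomy a b (λ a<b → L.<-asym (<-hom a<b) ⟦b⟧<⟦a⟧) (λ a≈b → L.<-irrefl (cong (K.sym a≈b)) ⟦b⟧<⟦a⟧) a≼b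

  0<-hom : ∀ {a} → K.0# K.< a → L.0# L.< ⟦ a ⟧
  0<-hom h = L.<-resp-≈ 0-hom L.refl (<-hom h)

  0≼-hom : ∀ {a} → K.0# K.≼ a → L.0# L.≼ ⟦ a ⟧
  0≼-hom h = L.≼-resp-≈ 0-hom L.refl (≼-hom h)

module CutProperties {c ℓ r p} {K : OrderedField c ℓ r} (C : Cut K p) (mult : IsMultiplicative C) where
  open OrderedFieldProperties K
  open Cut C
  open IsMultiplicative mult

  Lower-downward : ∀ {a b} → Lower b → a < b → Lower a
  Lower-downward {a} lb a<b with cover a
  ... | inj₁ la = la
  ... | inj₂ ua = ⊥-elim (<-asym a<b (below lb ua))

  Lower-resp-≈ : ∀ {a b} → Lower a → a ≈ b → Lower b
  Lower-resp-≈ {b = b} la a≈b with cover b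
  ... | inj₁ lb = lb
  ... | inj₂ ub = ⊥-elim (<-irrefl a≈b (below la ub))

  Lower-1 : Lower 1#
  Lower-1 = Lower-downward two-lower 1<two

  Lower-^ : ∀ {a} n → 0# < a → Lower a → Lower (a ^ n)
  Lower-^ zero    0<a la = Lower-1
  Lower-^ (suc n) 0<a la = mul-lower _ _ 0<a (0<^ n 0<a) la (Lower-^ n 0<a la)

  fromℕ<two^ : ∀ n → fromℕ n < two ^ n
  fromℕ<two^ zero    = 0<1
  fromℕ<two^ (suc n) = <-resp-≈ refl double≈two*
    (<-≼-trans (+-monoʳ-< 1# (fromℕ<two^ n)) (+-monoˡ-≼ (two ^ n) (1≼^ n (<⇒≼ 1<two))))
    where
    double≈two* : two ^ n + two ^ n ≈ two * two ^ n
    double≈two* = trans (+-cong (sym (*-identityˡ _)) (sym (*-identityˡ _))) (sym (distribʳ (two ^ n) 1# 1#))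

  Lower-fromℕ : ∀ n → Lower (fromℕ n)
  Lower-fromℕ n = Lower-downward (Lower-^ n 0<two two-lower) (fromℕ<two^ n)

  Upper-root : ∀ {a b} k → Upper a → 0# < b → b ^ k ≈ a → Upper b
  Upper-root {a} {b} k ua 0<b bᵏ≈a with cover b
  ... | inj₂ ub = ub
  ... | inj₁ lb = ⊥-elim (disjoint a (Lower-resp-≈ (Lower-^ k 0<b lb) bᵏ≈a , ua))

module RealClosedProperties {c ℓ r} {K : OrderedField c ℓ r} (rc : IsRealClosed K) where
  open OrderedFieldProperties K
  open IsRealClosed rc
  open import Relation.Binary.Reasoning.Setoid setoid

  positive-sqrt : ∀ {a} → 0# < a → ∃ λ b → (0# < b) × (b * b ≈ a)
  positive-sqrt {a} 0<a with sqrt a (inj₁ 0<a)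
  ... | b , b²≈a with <-total 0# b (λ 0≈b → <-irrefl (trans (sym (trans (*-congʳ (sym 0≈b)) (zeroˡ b))) b²≈a) 0<a)
  ...   | inj₁ 0<b = b , 0<b , b²≈a
  ...   | inj₂ b<0 = - b , <-resp-≈ -0#≈0# refl (neg-antimono-< b<0) , trans (solve 1 (λ b → :- b :* :- b := b :* b) refl b) b²≈a

  positive-root-2^ : ∀ {a} → 0# < a → ∀ m → ∃ λ b → (0# < b) × (b ^ (2 ℕ.^ m) ≈ a)
  positive-root-2^ {a} 0<a zero = a , 0<a , *-identityʳ a
  positive-root-2^ {a} 0<a (suc m) with positive-root-2^ 0<a m
  ... | b , 0<b , bᴺ≈a with positive-sqrt 0<b
  ...   | b′ , 0<b′ , b′²≈b = b′ , 0<b′ , (begin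
    b′ ^ (2 ℕ.^ suc m)                   ≈⟨ reflexive (≡.cong (λ k → b′ ^ (N ℕ.+ k)) (ℕₚ.+-identityʳ N)) ⟩
    b′ ^ (N ℕ.+ N)                       ≈⟨ ^-distribˡ-+-* b′ N N ⟩
    b′ ^ N * b′ ^ N                      ≈⟨ sym (^-distribʳ-* b′ b′ N) ⟩
    (b′ * b′) ^ N                        ≈⟨ ^-congˡ N b′²≈b ⟩
    b ^ N                                ≈⟨ bᴺ≈a ⟩
    a                                    ∎)
    where N = 2 ℕ.^ m

module OrderedFieldBounds {c ℓ r} (F : OrderedField c ℓ r) where
  open OrderedFieldProperties F

  ≼-cancel-scale : ∀ {σ ν u Y W} → 0# < σ → 0# ≼ Y → σ * ν ≼ u → u * Y ≼ σ * W → ν * Y ≼ W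
  ≼-cancel-scale {σ} {ν} {u} {Y} 0<σ 0≼Y σν≼u uY≼σW =
    *-cancelˡ-≼ 0<σ (≼-trans (≈⇒≼ (sym (*-assoc σ ν Y))) (≼-trans (*-monoˡ-≼ 0≼Y σν≼u) uY≼σW))

  ≈±⇒∣∣≼ : ∀ {a b} → 0# ≼ b → a ≈± b → ∣ a ∣≼ b
  ≈±⇒∣∣≼ 0≼b (inj₁ a≈b)  = ≼-resp-≈ refl (sym a≈b) (0≼x⇒-x≼x 0≼b) , ≈⇒≼ a≈b
  ≈±⇒∣∣≼ 0≼b (inj₂ a≈-b) = ≈⇒≼ (sym a≈-b) , ≼-resp-≈ (sym a≈-b) refl (0≼x⇒-x≼x 0≼b)

  fromℕ-suc-*-≼⇒< : ∀ {a b} n → 0# < b → fromℕ (suc n) * a ≼ fromℕ n * b → a < b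
  fromℕ-suc-*-≼⇒< {a} {b} n 0<b h = <-stable λ b≼a → b+nb≼0+nb b≼a (+-mono-< (fromℕ n * b) 0<b)
    where
    b+nb≼0+nb : b ≼ a → b + fromℕ n * b ≼ 0# + fromℕ n * b
    b+nb≼0+nb b≼a = ≼-trans (≈⇒≼ (trans (+-congʳ (sym (*-identityˡ b))) (sym (distribʳ b 1# (fromℕ n)))))
      (≼-trans (*-monoʳ-≼ (0≼fromℕ (suc n)) b≼a) (≼-trans h (≈⇒≼ (sym (+-identityˡ _)))))

  dominant-summand-does-not-cancel : ∀ {t s B S} → S < B → t ≈± B → ∣ s ∣≼ S → ¬ (t + s ≈ 0#)
  dominant-summand-does-not-cancel {t} {s} {B} {S} S<B t≈±B (-S≼s , s≼S) t+s≈0 = B≼S S<B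
    where
    s≈-t : s ≈ - t
    s≈-t = trans (solve 2 (λ t s → s := (t :+ s) :- t) refl t s) (trans (+-congʳ t+s≈0) (+-identityˡ _))
    B≼S : B ≼ S
    B≼S = [ (λ t≈B → ≼-resp-≈ (-‿involutive B) (-‿involutive S) (neg-antimono-≼ (≼-resp-≈ refl (trans s≈-t (-‿cong t≈B)) -S≼s)))
          , (λ t≈-B → ≼-resp-≈ (trans s≈-t (trans (-‿cong t≈-B) (-‿involutive B))) refl s≼S) ] t≈±B

  sumOf : ∀ {a} {A : Set a} → (A → Carrier) → List A → Carrier
  sumOf f []       = 0#
  sumOf f (k ∷ ks) = f k + sumOf f ks

  sumOf-++ : ∀ {a} {A : Set a} (f : A → Carrier) ks ls → sumOf f (ks ++ ls) ≈ sumOf f ks + sumOf f ls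
  sumOf-++ f []       ls = sym (+-identityˡ _)
  sumOf-++ f (k ∷ ks) ls = trans (+-congˡ (sumOf-++ f ks ls)) (sym (+-assoc _ _ _))

  sumOf-map : ∀ {a b} {A : Set a} {B : Set b} (f : B → Carrier) (g : A → B) ks → sumOf f (map g ks) ≡ sumOf (λ k → f (g k)) ks
  sumOf-map f g []       = ≡.refl
  sumOf-map f g (k ∷ ks) = ≡.cong (f (g k) +_) (sumOf-map f g ks)

  sumOf-∣∣≼ : ∀ {a} {A : Set a} {f g : A → Carrier} → (∀ k → ∣ f k ∣≼ g k) → ∀ ks → ∣ sumOf f ks ∣≼ sumOf g ks
  sumOf-∣∣≼ h []       = ≈⇒≼ -0#≈0# , ≼-refl
  sumOf-∣∣≼ {g = g} h (k ∷ ks) with h k | sumOf-∣∣≼ h ks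
  ... | lo , hi | lo′ , hi′ = ≼-resp-≈ (-‿+-comm (g k) (sumOf g ks)) refl (+-mono-≼ lo lo′) , +-mono-≼ hi hi′

  *-sumOf-≼ : ∀ {a} {A : Set a} (f : A → Carrier) ν b ks → All (λ k → ν * f k ≼ b) ks → ν * sumOf f ks ≼ fromℕ (length ks) * b
  *-sumOf-≼ f ν b []       []       = ≈⇒≼ (trans (zeroʳ ν) (sym (zeroˡ b)))
  *-sumOf-≼ f ν b (k ∷ ks) (h ∷ hs) =
    ≼-resp-≈ (sym (distribˡ ν (f k) (sumOf f ks))) (trans (+-congʳ (sym (*-identityˡ b))) (sym (distribʳ b 1# _)))
      (+-mono-≼ h (*-sumOf-≼ f ν b ks hs))

module _ {a p} {A : Set a} {P : A → Set p} where
  open import Data.List.Relation.Unary.All.Properties using (++⁻; ++⁺)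

  All-remove : ∀ xs {d} ys → All P (xs ++ d ∷ ys) → P d × All P (xs ++ ys)
  All-remove xs ys h with ++⁻ xs h
  ... | pxs , pd ∷ pys = pd , ++⁺ pxs pys

module _ {a r} {A : Set a} {R : A → A → Set r} (R-sym : ∀ {x y} → R x y → R y x) where

  AllPairs-remove : ∀ xs {d} ys → AllPairs R (xs ++ d ∷ ys) → All (λ x → R x d) (xs ++ ys)
  AllPairs-remove []       ys (rd ∷ _)  = All.map R-sym rd
  AllPairs-remove (x ∷ xs) ys (rx ∷ rs) = proj₁ (All-remove xs ys rx) ∷ AllPairs-remove xs ys rs

module ¬¬Maximum {a b} {A : Set a} (R : A → A → Set b)
                 (R-total : ∀ x y → ¬ ¬ (R x y ⊎ R y x))
                 (R-trans : ∀ {x y z} → R x y → R y z → R x z)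
                 (R-refl : ∀ {x} → R x x) where

  record Maximum (xs : List A) : Set (a ⊔ b) where
    field
      before  : List A
      maximum : A
      after   : List A
      split   : xs ≡ before ++ maximum ∷ after
      bounded : All (λ k → R k maximum) xs

  ¬¬maximum : ∀ x xs → ¬ ¬ Maximum (x ∷ xs)
  ¬¬maximum x []       k = k (record { before = [] ; maximum = x ; after = [] ; split = ≡.refl ; bounded = R-refl ∷ [] })
  ¬¬maximum x (y ∷ ys) k = ¬¬maximum y ys λ m → let open Maximum m in R-total x maximum λ where
    (inj₁ x≤m) → k (record { before = x ∷ before ; maximum = maximum ; after = after
                           ; split = ≡.cong (x ∷_) split ; bounded = x≤m ∷ bounded })
    (inj₂ m≤x) → k (record { before = [] ; maximum = x ; after = y ∷ ys
                           ; split = ≡.refl ; bounded = R-refl ∷ All.map (λ k≤m → R-trans k≤m m≤x) bounded })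

record Monomial {a} (A : Set a) : Set a where
  constructor monomial
  field
    coeff : A
    degˣ  : ℕ
    degʸ  : ℕ
open Monomial public

module _ {a} {A : Set a} where
  open import Data.List.Relation.Unary.All.Properties using (++⁺)
  import Data.List.Relation.Unary.AllPairs.Properties as AllPairs

  DistinctExponents : Monomial A → Monomial A → Set
  DistinctExponents m m′ = ¬ ((degˣ m ≡ degˣ m′) × (degʸ m ≡ degʸ m′))

  DistinctExponents-sym : ∀ {m m′} → DistinctExponents m m′ → DistinctExponents m′ m
  DistinctExponents-sym d (eˣ , eʸ) = d (≡.sym eˣ , ≡.sym eʸ)

  transpose : Monomial A → Monomial A
  transpose m = monomial (coeff m) (degʸ m) (degˣ m)

  transpose-distinct : ∀ {m m′} → DistinctExponents m m′ → DistinctExponents (transpose m) (transpose m′)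
  transpose-distinct d (eʸ , eˣ) = d (eˣ , eʸ)

  rowMonomials : ℕ → ℕ → List A → List (Monomial A)
  rowMonomials i j []       = []
  rowMonomials i j (c ∷ cs) = monomial c i j ∷ rowMonomials (suc i) j cs

  monomials : ℕ → List (List A) → List (Monomial A)
  monomials j []         = []
  monomials j (cs ∷ css) = rowMonomials 0 j cs ++ monomials (suc j) css

  maxLength : List (List A) → ℕ
  maxLength []         = 0
  maxLength (cs ∷ css) = length cs ℕ.⊔ maxLength css

  rowMonomials-degrees : ∀ i j cs → All (λ m → (i ℕ.≤ degˣ m) × (degʸ m ≡ j)) (rowMonomials i j cs)
  rowMonomials-degrees i j []       = []
  rowMonomials-degrees i j (c ∷ cs) =
    (ℕₚ.≤-refl , ≡.refl) ∷ All.map (λ (i<dˣ , eʸ) → ℕₚ.<⇒≤ i<dˣ , eʸ) (rowMonomials-degrees (suc i) j cs)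

  rowMonomials-distinct : ∀ i j cs → AllPairs DistinctExponents (rowMonomials i j cs)
  rowMonomials-distinct i j []       = []
  rowMonomials-distinct i j (c ∷ cs) =
    All.map (λ (i<dˣ , _) (eˣ , _) → ℕₚ.<-irrefl eˣ i<dˣ) (rowMonomials-degrees (suc i) j cs) ∷ rowMonomials-distinct (suc i) j cs

  monomials-degʸ≥ : ∀ j css → All (λ m → j ℕ.≤ degʸ m) (monomials j css)
  monomials-degʸ≥ j []         = []
  monomials-degʸ≥ j (cs ∷ css) =
    ++⁺ (All.map (λ (_ , eʸ) → ℕₚ.≤-reflexive (≡.sym eʸ)) (rowMonomials-degrees 0 j cs))
        (All.map ℕₚ.<⇒≤ (monomials-degʸ≥ (suc j) css))

  monomials-distinct : ∀ j css → AllPairs DistinctExponents (monomials j css)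
  monomials-distinct j []         = []
  monomials-distinct j (cs ∷ css) = AllPairs.++⁺ (rowMonomials-distinct 0 j cs) (monomials-distinct (suc j) css)
    (All.map (λ (_ , eʸ) → All.map (λ j<dʸ (_ , eʸ′) → ℕₚ.<-irrefl (≡.trans (≡.sym eʸ) eʸ′) j<dʸ) (monomials-degʸ≥ (suc j) css))
             (rowMonomials-degrees 0 j cs))

  rowMonomials-degˣ< : ∀ i j cs → All (λ m → degˣ m ℕ.< i ℕ.+ length cs) (rowMonomials i j cs)
  rowMonomials-degˣ< i j []       = []
  rowMonomials-degˣ< i j (c ∷ cs) = ℕₚ.m<m+n i (ℕ.s≤s ℕ.z≤n)
    ∷ All.map (λ {m} dˣ< → ≡.subst (degˣ m ℕ.<_) (≡.sym (ℕₚ.+-suc i (length cs))) dˣ<) (rowMonomials-degˣ< (suc i) j cs)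

  monomials-degˣ< : ∀ j css → All (λ m → degˣ m ℕ.< maxLength css) (monomials j css)
  monomials-degˣ< j []         = []
  monomials-degˣ< j (cs ∷ css) = ++⁺
    (All.map (λ dˣ< → ℕₚ.<-≤-trans dˣ< (ℕₚ.m≤m⊔n _ _)) (rowMonomials-degˣ< 0 j cs))
    (All.map (λ dˣ< → ℕₚ.<-≤-trans dˣ< (ℕₚ.m≤n⊔m (length cs) _)) (monomials-degˣ< (suc j) css))

  monomials-degʸ< : ∀ j css → All (λ m → degʸ m ℕ.< j ℕ.+ length css) (monomials j css)
  monomials-degʸ< j []         = []
  monomials-degʸ< j (cs ∷ css) = ++⁺
    (All.map (λ {m} (_ , eʸ) → ≡.subst (ℕ._< j ℕ.+ suc (length css)) (≡.sym eʸ) (ℕₚ.m<m+n j (ℕ.s≤s ℕ.z≤n))) (rowMonomials-degrees 0 j cs))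
    (All.map (λ {m} dʸ< → ≡.subst (degʸ m ℕ.<_) (≡.sym (ℕₚ.+-suc j (length css))) dʸ<) (monomials-degʸ< (suc j) css))

  monomials-degrees≤ : ∀ css → All (λ m → (degˣ m ℕ.≤ maxLength css ℕ.⊔ length css) × (degʸ m ℕ.≤ maxLength css ℕ.⊔ length css))
                                   (monomials 0 css)
  monomials-degrees≤ css = All.zipWith
    (λ (dˣ< , dʸ<) → ℕₚ.<⇒≤ (ℕₚ.<-≤-trans dˣ< (ℕₚ.m≤m⊔n _ _)) , ℕₚ.<⇒≤ (ℕₚ.<-≤-trans dʸ< (ℕₚ.m≤n⊔m _ _)))
    (monomials-degˣ< 0 css , monomials-degʸ< 0 css)

module MonomialEvaluation {c ℓ r c′ ℓ′ r′} {K : OrderedField c ℓ r} {L : OrderedField c′ ℓ′ r′}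
                          (ι : OFEmbedding K L) where
  private
    module K = OrderedFieldProperties K
  open OrderedFieldProperties L
  open OrderedFieldBounds L using (sumOf; sumOf-++)
  open EmbeddingProperties ι using (⟦_⟧; 0-hom; ≼-hom)
  open import Data.List.Relation.Unary.Any using (Any; here; there)
  open import Data.List.Relation.Unary.All.Properties using (++⁻ˡ; ++⁻ʳ)

  evalMonomial : Carrier → Carrier → Monomial K.Carrier → Carrier
  evalMonomial u v m = ⟦ coeff m ⟧ * (u ^ degˣ m * v ^ degʸ m)

  evalCoeffs : Carrier → List K.Carrier → Carrier
  evalCoeffs x cs = evalPoly (map ⟦_⟧ cs) x

  rowMonomials-sum : ∀ x y i j cs → sumOf (evalMonomial x y) (rowMonomials i j cs) ≈ (x ^ i * y ^ j) * evalCoeffs x cs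
  rowMonomials-sum x y i j []       = sym (zeroʳ _)
  rowMonomials-sum x y i j (c ∷ cs) = trans (+-congˡ (rowMonomials-sum x y (suc i) j cs))
    (solve 5 (λ a X Y x e → a :* (X :* Y) :+ ((x :* X) :* Y) :* e := (X :* Y) :* (a :+ x :* e)) refl
      ⟦ c ⟧ (x ^ i) (y ^ j) x (evalCoeffs x cs))

  monomials-sum : ∀ x y j css →
    sumOf (evalMonomial x y) (monomials j css) ≈ y ^ j * evalPoly (map (evalCoeffs x) css) y
  monomials-sum x y j []         = sym (zeroʳ _)
  monomials-sum x y j (cs ∷ css) = trans (sumOf-++ (evalMonomial x y) (rowMonomials 0 j cs) (monomials (suc j) css))
    (trans (+-cong (trans (rowMonomials-sum x y 0 j cs) (*-congʳ (*-identityˡ _))) (monomials-sum x y (suc j) css))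
    (solve 4 (λ Y e y f → Y :* e :+ (y :* Y) :* f := Y :* (e :+ y :* f)) refl
      (y ^ j) (evalCoeffs x cs) y (evalPoly (map (evalCoeffs x) css) y)))

  transpose-sum : ∀ x y ms → sumOf (evalMonomial y x) (map transpose ms) ≈ sumOf (evalMonomial x y) ms
  transpose-sum x y []       = refl
  transpose-sum x y (m ∷ ms) = +-cong (*-congˡ (*-comm _ _)) (transpose-sum x y ms)

  module _ {x} (0≼x : 0# ≼ x) where

    rowMonomials-zero : ∀ i j cs → All (λ m → coeff m K.≍ K.0#) (rowMonomials i j cs) → evalCoeffs x cs ≍ 0#
    rowMonomials-zero i j []       []                = ≼-refl , ≼-refl
    rowMonomials-zero i j (c ∷ cs) ((c≼0 , 0≼c) ∷ hs) with rowMonomials-zero (suc i) j cs hs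
    ... | e≼0 , 0≼e =
      ≼-resp-≈ refl (+-identityˡ 0#) (+-mono-≼ (≼-resp-≈ refl 0-hom (≼-hom c≼0)) (≼-resp-≈ refl (zeroʳ x) (*-monoʳ-≼ 0≼x e≼0))) ,
      ≼-resp-≈ (+-identityˡ 0#) refl (+-mono-≼ (≼-resp-≈ 0-hom refl (≼-hom 0≼c)) (≼-resp-≈ (zeroʳ x) refl (*-monoʳ-≼ 0≼x 0≼e)))

    monomials-nonzero : ∀ j css → Any (λ cs → ¬ (evalCoeffs x cs ≈ 0#)) css →
                        ¬ All (λ m → coeff m K.≍ K.0#) (monomials j css)
    monomials-nonzero j (cs ∷ css) (here e≉0)  h with rowMonomials-zero 0 j cs (++⁻ˡ (rowMonomials 0 j cs) h)
    ... | e≼0 , 0≼e = trichotomy _ _ 0≼e e≉0 e≼0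
    monomials-nonzero j (cs ∷ css) (there any) h = monomials-nonzero (suc j) css any (++⁻ʳ (rowMonomials 0 j cs) h)

n≤2^n : ∀ n → n ℕ.≤ 2 ℕ.^ n
n≤2^n zero    = ℕ.z≤n
n≤2^n (suc n) = ℕₚ.+-mono-≤ (ℕₚ.m^n>0 2 n) (ℕₚ.≤-trans (n≤2^n n) (ℕₚ.m≤m+n (2 ℕ.^ n) 0))

module DominantMonomial {c ℓ r c′ ℓ′ r′ p} {K : OrderedField c ℓ r} {L : OrderedField c′ ℓ′ r′}
                        (ι : OFEmbedding K L) (rcK : IsRealClosed K) (C : Cut K p) (mult : IsMultiplicative C) where
  private
    module K = OrderedFieldProperties K
  open OrderedFieldProperties L
  open OrderedFieldBounds L
  open EmbeddingProperties ι
  open CutProperties C mult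
  open RealClosedProperties rcK
  open MonomialEvaluation ι
  open Cut C
  open IsMultiplicative mult
  open import Relation.Binary.Bundles using (DecTotalOrder)
  open import Data.Product.Relation.Binary.Lex.NonStrict using (×-decTotalOrder)
  open import Relation.Nullary.Decidable using (¬¬-excluded-middle)
  open import Data.List.Relation.Unary.All.Properties using (map⁺; map⁻)
  import Data.List.Relation.Unary.AllPairs.Properties as AllPairs
  import Data.List.Relation.Unary.AllPairs as AllPairs′

  -- |c| cannot be computed without deciding the sign of c, so sizes are attached
  -- to the monomials under a double negation (¬¬sized).
  record SizedMonomial : Set (c ⊔ ℓ ⊔ r) where
    field
      mono    : Monomial K.Carrier
      size    : K.Carrier
      0≼size  : K.0# K.≼ size
      coeff≈± : coeff mono K.≈± size
  open SizedMonomial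

  ¬¬sized : ∀ ms → ¬ ¬ (Σ (List SizedMonomial) λ ks → map mono ks ≡ ms)
  ¬¬sized []       k = k ([] , ≡.refl)
  ¬¬sized (m ∷ ms) k = ¬¬sized ms λ (ks , eq) → ¬¬-excluded-middle λ where
    (yes c<0) → k (record { mono = m ; size = K.- coeff m
                          ; 0≼size = K.<⇒≼ (K.<-resp-≈ K.-0#≈0# K.refl (K.neg-antimono-< c<0))
                          ; coeff≈± = inj₂ (K.sym (K.-‿involutive _)) } ∷ ks , ≡.cong (m ∷_) eq)
    (no c≮0)  → k (record { mono = m ; size = coeff m ; 0≼size = c≮0 ; coeff≈± = inj₁ K.refl } ∷ ks , ≡.cong (m ∷_) eq)

  size≼0⇒coeff≍0 : ∀ k → size k K.≼ K.0# → coeff (mono k) K.≍ K.0#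
  size≼0⇒coeff≍0 k s≼0 with coeff≈± k
  ... | inj₁ c≈s  = K.≼-resp-≈ (K.sym c≈s) K.refl s≼0 , K.≼-resp-≈ K.refl (K.sym c≈s) (0≼size k)
  ... | inj₂ c≈-s = K.≼-resp-≈ (K.sym c≈-s) K.-0#≈0# (K.neg-antimono-≼ (0≼size k))
                  , K.≼-resp-≈ K.-0#≈0# (K.sym c≈-s) (K.neg-antimono-≼ s≼0)

  private
    module Lex = DecTotalOrder (×-decTotalOrder ℕₚ.≤-decTotalOrder ℕₚ.≤-decTotalOrder)

  Distinct : SizedMonomial → SizedMonomial → Set
  Distinct k k′ = DistinctExponents (mono k) (mono k′)

  Distinct-sym : ∀ {k k′} → Distinct k k′ → Distinct k′ k
  Distinct-sym {k} {k′} = DistinctExponents-sym {m = mono k} {mono k′}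

  LexBelow : SizedMonomial → SizedMonomial → Set
  LexBelow k k′ = (degʸ (mono k) , degˣ (mono k)) Lex.≤ (degʸ (mono k′) , degˣ (mono k′))

  1<realizer : ∀ {w} → Realizes ι C w → 1# < w
  1<realizer rw = <-resp-≈ 1-hom refl (proj₁ rw K.1# Lower-1)

  module _ (u v : Carrier) (ru : Realizes ι C u) (rv : Realizes ι C v) (D : ℕ) (uᴰ⁺¹≼v : u ^ suc D ≼ v) where

    powers : SizedMonomial → Carrier
    powers k = u ^ degˣ (mono k) * v ^ degʸ (mono k)

    term : SizedMonomial → Carrier
    term k = ⟦ coeff (mono k) ⟧ * powers k

    termSize : SizedMonomial → Carrier
    termSize k = ⟦ size k ⟧ * powers k

    1≼u : 1# ≼ u
    1≼u = <⇒≼ (1<realizer ru)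

    1≼v : 1# ≼ v
    1≼v = <⇒≼ (1<realizer rv)

    0≼u : 0# ≼ u
    0≼u = ≼-trans (<⇒≼ 0<1) 1≼u

    0≼v : 0# ≼ v
    0≼v = ≼-trans (<⇒≼ 0<1) 1≼v

    1≼powers : ∀ k → 1# ≼ powers k
    1≼powers k = ≼-resp-≈ (*-identityˡ 1#) refl
      (*-mono-≼ (<⇒≼ 0<1) (<⇒≼ 0<1) (1≼^ (degˣ (mono k)) 1≼u) (1≼^ (degʸ (mono k)) 1≼v))

    0≼powers : ∀ k → 0# ≼ powers k
    0≼powers k = ≼-trans (<⇒≼ 0<1) (1≼powers k)

    0≼termSize : ∀ k → 0# ≼ termSize k
    0≼termSize k = 0≼* (0≼-hom (0≼size k)) (0≼powers k)

    term≈±termSize : ∀ k → term k ≈± termSize k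
    term≈±termSize k with coeff≈± k
    ... | inj₁ c≈s  = inj₁ (*-congʳ (cong c≈s))
    ... | inj₂ c≈-s = inj₂ (trans (*-congʳ (trans (cong c≈-s) (-‿hom _))) (sym (-‿distribˡ-* _ _)))

    -- One more power of v outweighs u times the whole x-degree range, as u ^ suc D ≼ v.
    u*powers≼powers : ∀ k d → degˣ (mono k) ℕ.≤ D → Distinct k d → LexBelow k d →
                      u * powers k ≼ powers d
    u*powers≼powers k d dˣ≤D _ (inj₁ (dʸ≤ , dʸ≢)) =
      ≼-trans (≈⇒≼ (sym (*-assoc u _ _)))
      (≼-trans (*-monoˡ-≼ (0≼^ j 0≼v) (^-monoʳ-≼ 1≼u (ℕ.s≤s dˣ≤D)))
      (≼-trans (*-monoˡ-≼ (0≼^ j 0≼v) uᴰ⁺¹≼v)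
      (≼-trans (^-monoʳ-≼ 1≼v (ℕₚ.≤∧≢⇒< dʸ≤ dʸ≢))
      (≼-resp-≈ (*-identityˡ _) refl (*-monoˡ-≼ (0≼^ (degʸ (mono d)) 0≼v) (1≼^ (degˣ (mono d)) 1≼u))))))
      where j = degʸ (mono k)
    u*powers≼powers k d _ distinct (inj₂ (dʸ≡ , dˣ≤)) =
      ≼-trans (≈⇒≼ (sym (*-assoc u _ _)))
      (≼-resp-≈ refl (*-congˡ (reflexive (≡.cong (v ^_) dʸ≡)))
        (*-monoˡ-≼ (0≼^ (degʸ (mono k)) 0≼v) (^-monoʳ-≼ 1≼u (ℕₚ.≤∧≢⇒< dˣ≤ λ dˣ≡ → distinct (dˣ≡ , dʸ≡)))))

    -- Through a 2ᴱ-th root ρ of a with 2ᴱ > i + j: ρ ∈ C⁺ because C⁻ is closed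
    -- under powers, hence u, v < ρ.
    u*powers≼upper : ∀ k {a} → Upper a → K.0# K.< a → u * powers k ≼ ⟦ a ⟧
    u*powers≼upper k {a} ua 0<a =
      ≼-trans (*-mono-≼ 0≼u (0≼powers k) (<⇒≼ u<ρ)
                (*-mono-≼ (0≼^ i 0≼u) (0≼^ j 0≼v) (^-monoˡ-≼ i 0≼u (<⇒≼ u<ρ)) (^-monoˡ-≼ j 0≼v (<⇒≼ v<ρ))))
      (≼-trans (≈⇒≼ (*-congˡ (sym (^-distribˡ-+-* ⟦ ρ ⟧ i j))))
      (≼-trans (^-monoʳ-≼ (≼-trans 1≼u (<⇒≼ u<ρ)) (n≤2^n E))
      (≈⇒≼ (trans (sym (^-hom ρ (2 ℕ.^ E))) (cong ρᴺ≈a)))))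
      where
      i = degˣ (mono k)
      j = degʸ (mono k)
      E = suc (i ℕ.+ j)
      root = positive-root-2^ 0<a E
      ρ = proj₁ root
      ρᴺ≈a = proj₂ (proj₂ root)
      ρ-upper = Upper-root (2 ℕ.^ E) ua (proj₁ (proj₂ root)) ρᴺ≈a
      u<ρ = proj₂ ru ρ ρ-upper
      v<ρ = proj₂ rv ρ ρ-upper

    module WithMaximalSize (ks : List SizedMonomial) (m : SizedMonomial)
                           (≼size-m : All (λ k → size k K.≼ size m) ks)
                           (nonzero : ¬ All (λ k → size k K.≼ K.0#) ks) where
      A = size m

      0<A : K.0# K.< A
      0<A = K.<-stable λ A≼0 → nonzero (All.map (λ s≼A → K.≼-trans s≼A A≼0) ≼size-m)

      -- Relative to the maximal size A, a monomial is large when A / size ∈ C⁻ and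
      -- small when A / size ∈ C⁺; every monomial of nonzero size is one of the two.
      Large : SizedMonomial → Set (c ⊔ r ⊔ p)
      Large k = Σ K.Carrier λ s → Lower s × (K.0# K.< s) × (A K.≼ s K.* size k)

      Small : SizedMonomial → Set (c ⊔ r ⊔ p)
      Small k = Σ K.Carrier λ a → Upper a × (K.0# K.< a) × (size k K.* a K.≼ A)

      ¬¬classify : ∀ k → ¬ ¬ (Large k ⊎ Small k ⊎ size k K.≼ K.0#)
      ¬¬classify k κ = ¬¬-excluded-middle λ where
        (no s≯0)  → κ (inj₂ (inj₂ s≯0))
        (yes 0<s) → let (a , 0<a , A≈a*s) = K.positive-quotient 0<s 0<A
                    in [ (λ la → κ (inj₁ (a , la , 0<a , K.≈⇒≼ A≈a*s)))
                       , (λ ua → κ (inj₂ (inj₁ (a , ua , 0<a , K.≈⇒≼ (K.trans (K.*-comm _ _) (K.sym A≈a*s)))))) ] (cover a)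

      m-large : Large m
      m-large = K.1# , Lower-1 , K.0<1 , K.≈⇒≼ (K.sym (K.*-identityˡ A))

      LargeAbove : SizedMonomial → SizedMonomial → Set (c ⊔ r ⊔ p)
      LargeAbove k k′ = Large k → Large k′ × LexBelow k k′

      LargeAbove-total : ∀ k k′ → ¬ ¬ (LargeAbove k k′ ⊎ LargeAbove k′ k)
      LargeAbove-total k k′ κ = ¬¬-excluded-middle λ where
        (no ¬lk)  → κ (inj₁ (λ lk → ⊥-elim (¬lk lk)))
        (yes lk)  → ¬¬-excluded-middle λ where
          (no ¬lk′) → κ (inj₂ (λ lk′ → ⊥-elim (¬lk′ lk′)))
          (yes lk′) → [ (λ k≤k′ → κ (inj₁ (λ _ → lk′ , k≤k′))) , (λ k′≤k → κ (inj₂ (λ _ → lk , k′≤k))) ]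
                        (Lex.total _ _)

      LargeAbove-trans : ∀ {k k′ k″} → LargeAbove k k′ → LargeAbove k′ k″ → LargeAbove k k″
      LargeAbove-trans h h′ lk with h lk
      ... | lk′ , k≤k′ with h′ lk′
      ...   | lk″ , k′≤k″ = lk″ , Lex.trans k≤k′ k′≤k″

      LargeAbove-refl : ∀ {k} → LargeAbove k k
      LargeAbove-refl lk = lk , Lex.refl

      -- d will be the large monomial with lexicographically greatest (degʸ, degˣ).
      module WithDominant (d : SizedMonomial) (large-d : Large d) (before after : List SizedMonomial)
                          (split : ks ≡ before ++ d ∷ after) where
        others = before ++ after
        N = length others
        ν = fromℕ (suc N)
        s = proj₁ large-d
        σ = ⟦ s ⟧

        0<s : K.0# K.< s
        0<s = proj₁ (proj₂ (proj₂ large-d))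

        A≼σ*size-d : ⟦ A ⟧ ≼ σ * ⟦ size d ⟧
        A≼σ*size-d = ≼-resp-≈ refl (*-hom s (size d)) (≼-hom (proj₂ (proj₂ (proj₂ large-d))))

        σν≼u : σ * ν ≼ u
        σν≼u = <⇒≼ (<-resp-≈ (trans (*-hom s (K.fromℕ (suc N))) (*-congˡ (fromℕ-hom (suc N)))) refl
          (proj₁ ru _ (mul-lower _ _ 0<s (K.0<fromℕ-suc N) (proj₁ (proj₂ large-d)) (Lower-fromℕ (suc N)))))

        0<size-d : K.0# K.< size d
        0<size-d = K.<-stable λ size≼0 →
          K.≼-trans (proj₂ (proj₂ (proj₂ large-d))) (K.≼-resp-≈ K.refl (K.zeroʳ s) (K.*-monoʳ-≼ (K.<⇒≼ 0<s) size≼0)) 0<A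

        0<termSize-d : 0# < termSize d
        0<termSize-d = *-pos (0<-hom 0<size-d) (<-≼-trans 0<1 (1≼powers d))

        0≼σ : 0# ≼ σ
        0≼σ = <⇒≼ (0<-hom 0<s)

        A≼σ*termSize-d : ⟦ A ⟧ ≼ σ * termSize d
        A≼σ*termSize-d = ≼-trans A≼σ*size-d (≼-trans (≈⇒≼ (sym (*-identityʳ _)))
          (≼-trans (*-monoʳ-≼ (0≼* 0≼σ (0≼-hom (0≼size d))) (1≼powers d)) (≈⇒≼ (*-assoc σ _ _))))

        u*termSize≈ : ∀ k → u * termSize k ≈ ⟦ size k ⟧ * (u * powers k)
        u*termSize≈ k = solve 3 (λ u b X → u :* (b :* X) := b :* (u :* X)) refl u ⟦ size k ⟧ (powers k)

        large-dominated : ∀ k → degˣ (mono k) ℕ.≤ D → Distinct k d → LexBelow k d →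
                          size k K.≼ A → u * termSize k ≼ σ * termSize d
        large-dominated k dˣ≤D distinct k≤d size≼A =
          ≼-trans (≈⇒≼ (u*termSize≈ k))
          (≼-trans (*-mono-≼ (0≼-hom (0≼size k)) (0≼* 0≼u (0≼powers k)) (≼-hom size≼A) (u*powers≼powers k d dˣ≤D distinct k≤d))
          (≼-trans (*-monoˡ-≼ (0≼powers d) A≼σ*size-d) (≈⇒≼ (*-assoc σ _ _))))

        small-dominated : ∀ k → Small k → u * termSize k ≼ σ * termSize d
        small-dominated k (a , ua , 0<a , size*a≼A) =
          ≼-trans (≈⇒≼ (u*termSize≈ k))
          (≼-trans (*-monoʳ-≼ (0≼-hom (0≼size k)) (u*powers≼upper k ua 0<a))
          (≼-trans (≼-resp-≈ (*-hom (size k) a) refl (≼-hom size*a≼A)) A≼σ*termSize-d))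

        negligible-dominated : ∀ k → size k K.≼ K.0# → u * termSize k ≼ σ * termSize d
        negligible-dominated k size≼0 =
          ≼-trans (≼-resp-≈ refl (zeroʳ u) (*-monoʳ-≼ 0≼u termSize≼0)) (0≼* 0≼σ (0≼termSize d))
          where
          termSize≼0 : termSize k ≼ 0#
          termSize≼0 = ≼-resp-≈ refl (zeroˡ (powers k)) (*-monoˡ-≼ (0≼powers k) (≼-resp-≈ refl 0-hom (≼-hom size≼0)))

        dominated : ∀ k → degˣ (mono k) ℕ.≤ D → Distinct k d → LargeAbove k d →
                    size k K.≼ A → ν * termSize k ≼ termSize d
        dominated k dˣ≤D distinct above size≼A = ≼-cancel-scale (0<-hom 0<s) (0≼termSize k) σν≼u λ l →
          ¬¬classify k λ where
            (inj₁ large-k)        → large-dominated k dˣ≤D distinct (proj₂ (above large-k)) size≼A l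
            (inj₂ (inj₁ small-k)) → small-dominated k small-k l
            (inj₂ (inj₂ size≼0))  → negligible-dominated k size≼0 l

        sum-split : sumOf term ks ≈ term d + sumOf term others
        sum-split = begin
          sumOf term ks                                         ≡⟨ ≡.cong (sumOf term) split ⟩
          sumOf term (before ++ d ∷ after)                      ≈⟨ sumOf-++ term before (d ∷ after) ⟩
          sumOf term before + (term d + sumOf term after)       ≈⟨ solve 3 (λ a t b → a :+ (t :+ b) := t :+ (a :+ b)) refl _ _ _ ⟩
          term d + (sumOf term before + sumOf term after)       ≈⟨ +-congˡ (sym (sumOf-++ term before after)) ⟩
          term d + sumOf term others                            ∎
          where open import Relation.Binary.Reasoning.Setoid setoid

        cancellation-impossible : All (λ k → degˣ (mono k) ℕ.≤ D) ks →
                                  AllPairs Distinct ks →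
                                  All (λ k → LargeAbove k d) ks → ¬ (sumOf term ks ≈ 0#)
        cancellation-impossible dˣ≤D distinct above sum≈0 =
          dominant-summand-does-not-cancel sizes<termSize-d (term≈±termSize d)
            (sumOf-∣∣≼ (λ k → ≈±⇒∣∣≼ (0≼termSize k) (term≈±termSize k)) others)
            (trans (sym sum-split) sum≈0)
          where
          remove : ∀ {q} {Q : SizedMonomial → Set q} → All Q ks → All Q others
          remove h = proj₂ (All-remove before after (≡.subst (All _) split h))
          others-dominated : All (λ k → ν * termSize k ≼ termSize d) others
          others-dominated = All.zipWith (λ {k} (dˣ≤D , distinct , above , size≼A) → dominated k dˣ≤D distinct above size≼A)
            (remove dˣ≤D , All.zip (AllPairs-remove (λ {k} {k′} → Distinct-sym {k} {k′}) before after (≡.subst (AllPairs _) split distinct)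
                                   , All.zip (remove above , remove ≼size-m)))
          sizes<termSize-d : sumOf termSize others < termSize d
          sizes<termSize-d = fromℕ-suc-*-≼⇒< N 0<termSize-d (*-sumOf-≼ termSize ν (termSize d) others others-dominated)

    vanishing-sum-impossible : ∀ ks → All (λ k → degˣ (mono k) ℕ.≤ D) ks → AllPairs Distinct ks →
                               ¬ All (λ k → size k K.≼ K.0#) ks → ¬ (sumOf term ks ≈ 0#)
    vanishing-sum-impossible []         _    _        nonzero _      = nonzero []
    vanishing-sum-impossible ks@(k₀ ∷ ks₀) dˣ≤D distinct nonzero sum≈0 =
      BySize.¬¬maximum k₀ ks₀ λ bySize →
        let m = BySize.Maximum.maximum bySize
            open WithMaximalSize ks m (BySize.Maximum.bounded bySize) nonzero
            module ByLargeness = ¬¬Maximum LargeAbove LargeAbove-total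
                                   (λ {k} {k′} {k″} → LargeAbove-trans {k} {k′} {k″}) (λ {k} → LargeAbove-refl {k})
        in ByLargeness.¬¬maximum k₀ ks₀ λ byLargeness →
          let open ByLargeness.Maximum byLargeness
              m-below-d = proj₁ (All-remove (BySize.Maximum.before bySize) (BySize.Maximum.after bySize)
                                  (≡.subst (All _) (BySize.Maximum.split bySize) bounded))
          in WithDominant.cancellation-impossible maximum (proj₁ (m-below-d m-large)) before after split
               dˣ≤D distinct bounded sum≈0
      where
      module BySize = ¬¬Maximum (λ k k′ → size k K.≼ size k′) (λ k k′ → K.≼-total-¬¬ (size k) (size k′)) K.≼-trans K.≼-refl

  vanishing-monomial-sum⇒<^suc : ∀ {u v} → Realizes ι C u → Realizes ι C v → ∀ D ms →
                                 All (λ m → degˣ m ℕ.≤ D) ms → AllPairs DistinctExponents ms →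
                                 ¬ All (λ m → coeff m K.≍ K.0#) ms → sumOf (evalMonomial u v) ms ≈ 0# → v < u ^ suc D
  vanishing-monomial-sum⇒<^suc {u} {v} ru rv D ms dˣ≤D distinct nonzero sum≈0 = <-stable λ uᴰ⁺¹≼v →
    ¬¬sized ms λ where
      (ks , ≡.refl) → vanishing-sum-impossible u v ru rv D uᴰ⁺¹≼v ks (map⁻ dˣ≤D) (AllPairs.map⁻ distinct)
                        (λ h → nonzero (map⁺ (All.map (λ {k} → size≼0⇒coeff≍0 k) h)))
                        (trans (reflexive (≡.sym (sumOf-map (evalMonomial u v) mono ks))) sum≈0)

  vanishing-monomial-sum⇒<^suc-both : ∀ {u v} → Realizes ι C u → Realizes ι C v → ∀ D ms →
                                      All (λ m → (degˣ m ℕ.≤ D) × (degʸ m ℕ.≤ D)) ms → AllPairs DistinctExponents ms →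
                                      ¬ All (λ m → coeff m K.≍ K.0#) ms → sumOf (evalMonomial u v) ms ≈ 0# →
                                      (v < u ^ suc D) × (u < v ^ suc D)
  vanishing-monomial-sum⇒<^suc-both {u} {v} ru rv D ms deg≤D distinct nonzero sum≈0 =
    vanishing-monomial-sum⇒<^suc ru rv D ms (All.map proj₁ deg≤D) distinct nonzero sum≈0 ,
    vanishing-monomial-sum⇒<^suc rv ru D (map transpose ms) (map⁺ (All.map proj₂ deg≤D))
      (AllPairs.map⁺ (AllPairs′.map (λ {m} {m′} → transpose-distinct {m = m} {m′}) distinct))
      (λ h → nonzero (map⁻ h)) (trans (transpose-sum u v ms) sum≈0)

lemma2p9 : ∀ {c ℓ r c' ℓ' r' p} (K : OrderedField c ℓ r) → IsRealClosed K →
           (C : Cut K p) → IsMultiplicative C →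
           (L : OrderedField c' ℓ' r') (ι : OFEmbedding K L) (x : OrderedField.Carrier L) →
           IsRealClosureOfSimpleExt C L ι x →
           ∀ (y : OrderedField.Carrier L) → Realizes ι C y →
           ∃ λ (n : ℕ) → (1 ≤ n) ×
             ((∀ (t : OrderedField.Carrier L) → OrderedField._<_ L (OrderedField.0# L) t →
                 OrderedField._≈_ L (OrderedField._^_ L t n) x → OrderedField._<_ L t y)
              × OrderedField._<_ L y (OrderedField._^_ L x n))
lemma2p9 K rcK C mult L ι x rc y ry = suc D , ℕ.s≤s ℕ.z≤n , root<y , y<xᴰ⁺¹
  where
  open OrderedFieldProperties L
  open MonomialEvaluation ι
  open DominantMonomial ι rcK C mult
  open IsRealClosureOfSimpleExt rc

  css = proj₁ (algebraic y)
  D   = maxLength css ℕ.⊔ length css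

  bounds : (y < x ^ suc D) × (x < y ^ suc D)
  bounds = vanishing-monomial-sum⇒<^suc-both realizes ry D (monomials 0 css) (monomials-degrees≤ css)
    (monomials-distinct 0 css)
    (monomials-nonzero (<⇒≼ (<-trans 0<1 (1<realizer realizes))) 0 css (proj₁ (proj₂ (algebraic y))))
    (trans (monomials-sum x y 0 css) (trans (*-identityˡ _) (proj₂ (proj₂ (algebraic y)))))

  y<xᴰ⁺¹ = proj₁ bounds

  root<y : ∀ t → 0# < t → t ^ suc D ≈ x → t < y
  root<y t _ tᴰ⁺¹≈x = <-stable λ y≼t →
    ≼-resp-≈ refl tᴰ⁺¹≈x (^-monoˡ-≼ (suc D) (<⇒≼ (<-trans 0<1 (1<realizer ry))) y≼t) (proj₂ bounds)
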